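{- Under both the structure semantics and the tree semantics, $\mathsf{EQCTL}$ and $\mathsf{QCTL}$ are equally expressive: for every $\mathsf{QCTL}$ formula $\varphi$ there is an $\mathsf{EQCTL}$ formula $\psi$ with $\varphi\equiv_s\psi$, and for every $\mathsf{QCTL}$ formula $\varphi$ there is an $\mathsf{EQCTL}$ formula $\psi'$ with $\varphi\equiv_t\psi'$ (and every $\mathsf{EQCTL}$ formula is itself a $\mathsf{QCTL}$ formula).
   Context: Fix a set $AP$ of atomic propositions. A Kripke structure is $S=(Q,R,\ell)$ with $Q$ a countable set of states, $R\subseteq Q\times Q$ total (every state has a successor) and $\ell:Q\to 2^{AP}$; it is finite if $Q$ is finite. A path from $q$ is an infinite sequence $\rho=q_0q_1\dots$ with $q_0=q$ and $(q_i,q_{i+1})\in R$; $\rho^i$ is its suffix starting at position $i$. $\mathsf{QCTL}$ formulas are given by $\varphi::= p\mid\neg\varphi\mid\varphi\vee\varphi\mid\exists p.\varphi\mid \mathbf{E}\,\varphi\,\mathbf{U}\,\varphi\mid \mathbf{A}\,\varphi\,\mathbf{U}\,\varphi\mid \mathbf{EX}\varphi\mid\mathbf{AX}\varphi$ ($p\in AP$); $\mathsf{CTL}$ is the fragment without $\exists p$. Abbreviation: $\forall p.\varphi=\neg\exists p.\neg\varphi$. Structure semantics $\models_s$ (on possibly infinite Kripke structures): $S,q\models_s p$ iff $p\in\ell(q)$; Boolean connectives as usual; $S,q\models_s\exists p.\varphi$ iff there exists $S'=(Q,R,\ell')$ with $\ell'(r)\setminus\{p\}=\ell(r)\setminus\{p\}$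 for all $r\in Q$ and $S',q\models_s\varphi$; $\mathbf{EX}\varphi$ (resp. $\mathbf{AX}\varphi$) holds at $q$ iff some (resp. every) path from $q$ has $\varphi$ at its second state; $\mathbf{E}\varphi_1\mathbf{U}\varphi_2$ (resp. $\mathbf{A}\varphi_1\mathbf{U}\varphi_2$) holds at $q$ iff some (resp. every) path $\rho$ from $q$ has an $i\ge0$ with $\varphi_2$ at $\rho(i)$ and $\varphi_1$ at $\rho(j)$ for all $j<i$. Tree semantics: for finite $S$ and $q\in Q$, the unwinding $T_S(q)$ is the Kripke structure whose states are the finite prefixes of paths of $S$ from $q$, with transitions from each such prefix to its one-step extensions, each prefix labelled by $\ell$ of its last state; $S,q\models_t\varphi$ iff $T_S(q),q\models_s\varphi$ (where $q$ denotes the root). $\mathsf{EQCTL}$ is the set of formulas in prenex normal form $Q_1p_1\dots Q_np_n.\varphi$ with $Q_i\in\{\exists,\forall\}$ and $\varphi\in\mathsf{CTL}$. For formulas $\varphi,\psi$: $\varphi\equiv_s\psi$ iff for every finite Kripke structure $S$ and every state $q$, $S,q\models_s\varphi\iff S,q\models_s\psi$; $\varphi\equiv_t\psi$ likewise with $\models_t$. -}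

module Defs where

open import Level using (0ℓ)
open import Data.Nat using (ℕ; zero; suc; _<_)
open import Data.Bool using (Bool; T)
open import Data.Fin using (Fin)
open import Data.Product using (Σ; ∃; _×_; _,_; proj₁; proj₂)
open import Relation.Binary.PropositionalEquality using (_≡_; _≢_)
open import Relation.Nullary using (¬_)
open import Function.Bundles using (_⇔_)
open import Data.Sum using (_⊎_)

AP : Set
AP = ℕ

data Form : Set where
  prop   : AP → Form
  neg    : Form → Form
  or     : Form → Form → Form
  exists : AP → Form → Form
  EU     : Form → Form → Form
  AU     : Form → Form → Form
  EX     : Form → Form
  AX     : Form → Form

forall' : AP → Form → Form
forall' p φ = neg (exists p (neg φ))

data IsCTL : Form → Set where
  prop : ∀ p → IsCTL (prop p)
  neg  : ∀ {φ} → IsCTL φ → IsCTL (neg φ)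
  or   : ∀ {φ ψ} → IsCTL φ → IsCTL ψ → IsCTL (or φ ψ)
  EU   : ∀ {φ ψ} → IsCTL φ → IsCTL ψ → IsCTL (EU φ ψ)
  AU   : ∀ {φ ψ} → IsCTL φ → IsCTL ψ → IsCTL (AU φ ψ)
  EX   : ∀ {φ} → IsCTL φ → IsCTL (EX φ)
  AX   : ∀ {φ} → IsCTL φ → IsCTL (AX φ)

data IsEQCTL : Form → Set where
  ctl    : ∀ {φ} → IsCTL φ → IsEQCTL φ
  ex     : ∀ p {φ} → IsEQCTL φ → IsEQCTL (exists p φ)
  all    : ∀ p {φ} → IsEQCTL φ → IsEQCTL (forall' p φ)

record Kripke : Set₁ where
  field
    Q     : Set
    R     : Q → Q → Set
    total : ∀ q → ∃ λ r → R q r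
    ℓ     : Q → AP → Bool

record Path {Q : Set} (R : Q → Q → Set) (q : Q) : Set where
  field
    ρ     : ℕ → Q
    start : ρ 0 ≡ q
    step  : ∀ i → R (ρ i) (ρ (suc i))
open Path public

module _ {Q : Set} (R : Q → Q → Set) where
  satL : (Q → AP → Bool) → Q → Form → Set
  satL ℓ q (prop p)     = T (ℓ q p)
  satL ℓ q (neg φ)      = ¬ satL ℓ q φ
  satL ℓ q (or φ ψ)     = satL ℓ q φ ⊎ satL ℓ q ψ
  satL ℓ q (exists p φ) =
    Σ (Q → AP → Bool) λ ℓ′ →
      (∀ r a → a ≢ p → ℓ′ r a ≡ ℓ r a) × satL ℓ′ q φ
  satL ℓ q (EU φ ψ)     =
    Σ (Path R q) λ π → Σ ℕ λ i →
      satL ℓ (ρ π i) ψ × (∀ j → j < i → satL ℓ (ρ π j) φ)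
  satL ℓ q (AU φ ψ)     =
    (π : Path R q) → Σ ℕ λ i →
      satL ℓ (ρ π i) ψ × (∀ j → j < i → satL ℓ (ρ π j) φ)
  satL ℓ q (EX φ)       = Σ (Path R q) λ π → satL ℓ (ρ π 1) φ
  satL ℓ q (AX φ)       = (π : Path R q) → satL ℓ (ρ π 1) φ

_,_⊨s_ : (S : Kripke) → Kripke.Q S → Form → Set
S , q ⊨s φ = satL (Kripke.R S) (Kripke.ℓ S) q φ

record FinKripke : Set where
  field
    n     : ℕ
    R     : Fin n → Fin n → Bool
    total : ∀ q → ∃ λ r → T (R q r)
    ℓ     : Fin n → AP → Bool

toKripke : FinKripke → Kripke
toKripke S = record
  { Q = Fin n ; R = λ a b → T (R a b) ; total = total ; ℓ = ℓ }
  where open FinKripke S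

-- Unwinding T_S(q): states are finite path prefixes from q
-- (indexed by their last state), with transitions to one-step extensions.

module Unwind (S : FinKripke) (q : Fin (FinKripke.n S)) where
  open FinKripke S

  data Pre : Fin n → Set where
    here : Pre q
    snoc : ∀ {a b} → Pre a → T (R a b) → Pre b

  Node : Set
  Node = Σ (Fin n) Pre

  data Edge : Node → Node → Set where
    ext : ∀ {a b} (w : Pre a) (h : T (R a b)) → Edge (a , w) (b , snoc w h)

  tree : Kripke
  tree = record
    { Q = Node
    ; R = Edge
    ; total = λ { (a , w) → let (b , h) = total a in (b , snoc w h) , ext w h }
    ; ℓ = λ v → ℓ (proj₁ v)
    }

  root : Node
  root = q , here

_,_⊨t_ : (S : FinKripke) → Fin (FinKripke.n S) → Form → Set
S , q ⊨t φ = Unwind.tree S q , Unwind.root S q ⊨s φ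

_≡s_ : Form → Form → Set
φ ≡s ψ = (S : FinKripke) (q : Fin (FinKripke.n S)) →
  (toKripke S , q ⊨s φ) ⇔ (toKripke S , q ⊨s ψ)

_≡t_ : Form → Form → Set
φ ≡t ψ = (S : FinKripke) (q : Fin (FinKripke.n S)) →
  (S , q ⊨t φ) ⇔ (S , q ⊨t ψ)

module Submission where

-- The proof is a translation into prenex form,
-- correct over every Kripke structure (so both for the structure semantics
-- and for the tree semantics, which is the structure semantics on unwindings).
--
-- Boolean connectives and ∃ are handled by the classical prenex laws, using
-- fresh variables so that no quantifier captures a variable.  A temporal
-- operator applied to prenex formulas A, B is first rewritten by "marking":
--   apply o A B  ⇔  ∃z₁ ∃z₂. AG (z₁ → A) ∧ AG (z₂ → B) ∧ apply o z₁ z₂,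
-- and a quantifier prefix Q is pulled out of AG (z → Q. m) with a variable x
-- that marks a single state:
--   AG (z → Q. m)  ⇔  ∀x ∃y Q. TwoMarked x y ∨ AG (x ∧ z → m).

open import Defs
open import Level using (0ℓ)
open import Axiom.ExcludedMiddle using (ExcludedMiddle)
open import Axiom.DoubleNegationElimination using (DoubleNegationElimination; em⇒dne)
open import Data.Bool using (Bool; true; false; T)
open import Data.Empty using (⊥; ⊥-elim)
open import Data.List using (List; []; _∷_; _++_)
open import Data.List.Relation.Unary.All as All using (All; []; _∷_)
open import Data.List.Relation.Unary.All.Properties using (++⁺)
open import Data.Nat using (ℕ; suc; _<_; _≤_; _⊔_; _≟_)
open import Data.Nat.Properties
open import Data.Product using (Σ; _×_; _,_; proj₁; proj₂)
open import Data.Sum as Sum using (_⊎_; inj₁; inj₂; [_,_]; swap)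
open import Data.Sum.Function.Propositional using (_⊎-⇔_)
open import Function using (_∘_; id)
open import Function.Bundles using (_⇔_; mk⇔; Equivalence)
open import Function.Properties.Equivalence using (⇔-isEquivalence)
open import Function.Related.TypeIsomorphisms using (¬-cong-⇔)
open import Relation.Binary.PropositionalEquality using (_≡_; _≢_; refl; sym; trans; cong; subst)
open import Relation.Binary.Structures using (IsEquivalence)
open import Relation.Nullary using (¬_; yes; no)
open import Relation.Nullary.Decidable using (isYes; toWitness; fromWitness)
open import Relation.Unary using (Pred; _⊆_; _∪_; _∩_; ｛_｝)

-- Derived connectives.  The tautology inside EF and AG is built from the
-- argument itself, so that these abbreviations introduce no new variable.
conj : Form → Form → Form
conj φ ψ = neg (or (neg φ) (neg ψ))

impl : Form → Form → Form
impl φ ψ = or (neg φ) ψ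

EF : Form → Form
EF φ = EU (or φ (neg φ)) φ

AG : Form → Form
AG φ = neg (EU (or φ (neg φ)) (neg φ))

-- Some reachable x-state carries y and some reachable x-state does not.
-- Hence  ∃y. TwoMarked x y  says that x holds at two distinct reachable states.
TwoMarked : AP → AP → Form
TwoMarked x y = conj (EF (conj (prop x) (prop y))) (EF (conj (prop x) (neg (prop y))))

data Op : Set where
  opEX opAX opEU opAU : Op

apply : Op → Form → Form → Form
apply opEX φ ψ = EX φ
apply opAX φ ψ = AX φ
apply opEU φ ψ = EU φ ψ
apply opAU φ ψ = AU φ ψ

conj-CTL : ∀ {φ ψ} → IsCTL φ → IsCTL ψ → IsCTL (conj φ ψ)
conj-CTL hφ hψ = neg (or (neg hφ) (neg hψ))

EF-CTL : ∀ {φ} → IsCTL φ → IsCTL (EF φ)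
EF-CTL h = EU (or h (neg h)) h

AG-CTL : ∀ {φ} → IsCTL φ → IsCTL (AG φ)
AG-CTL h = neg (EU (or h (neg h)) (neg h))

TwoMarked-CTL : ∀ x y → IsCTL (TwoMarked x y)
TwoMarked-CTL x y =
  conj-CTL (EF-CTL (conj-CTL (prop x) (prop y))) (EF-CTL (conj-CTL (prop x) (neg (prop y))))

apply-CTL : ∀ o {φ ψ} → IsCTL φ → IsCTL ψ → IsCTL (apply o φ ψ)
apply-CTL opEX hφ hψ = EX hφ
apply-CTL opAX hφ hψ = AX hφ
apply-CTL opEU hφ hψ = EU hφ hψ
apply-CTL opAU hφ hψ = AU hφ hψ

AllVars : Pred AP 0ℓ → Form → Set
AllVars V (prop a)     = V a
AllVars V (neg φ)      = AllVars V φ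
AllVars V (or φ ψ)     = AllVars V φ × AllVars V ψ
AllVars V (exists p φ) = V p × AllVars V φ
AllVars V (EU φ ψ)     = AllVars V φ × AllVars V ψ
AllVars V (AU φ ψ)     = AllVars V φ × AllVars V ψ
AllVars V (EX φ)       = AllVars V φ
AllVars V (AX φ)       = AllVars V φ

AllVars-map : ∀ {V W : Pred AP 0ℓ} → V ⊆ W → ∀ φ → AllVars V φ → AllVars W φ
AllVars-map f (prop a)     h         = f h
AllVars-map f (neg φ)      h         = AllVars-map f φ h
AllVars-map f (or φ ψ)     (hφ , hψ) = AllVars-map f φ hφ , AllVars-map f ψ hψ
AllVars-map f (exists p φ) (hp , hφ) = f hp , AllVars-map f φ hφ
AllVars-map f (EU φ ψ)     (hφ , hψ) = AllVars-map f φ hφ , AllVars-map f ψ hψ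
AllVars-map f (AU φ ψ)     (hφ , hψ) = AllVars-map f φ hφ , AllVars-map f ψ hψ
AllVars-map f (EX φ)       h         = AllVars-map f φ h
AllVars-map f (AX φ)       h         = AllVars-map f φ h

apply-vars : ∀ {V : Pred AP 0ℓ} o {φ ψ} → AllVars V φ → AllVars V ψ → AllVars V (apply o φ ψ)
apply-vars opEX hφ hψ = hφ
apply-vars opAX hφ hψ = hφ
apply-vars opEU hφ hψ = hφ , hψ
apply-vars opAU hφ hψ = hφ , hψ

conj-vars : ∀ {V : Pred AP 0ℓ} {φ ψ} → AllVars V φ → AllVars V ψ → AllVars V (conj φ ψ)
conj-vars hφ hψ = hφ , hψ

EF-vars : ∀ {V : Pred AP 0ℓ} {φ} → AllVars V φ → AllVars V (EF φ)
EF-vars h = (h , h) , h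

AG-vars : ∀ {V : Pred AP 0ℓ} {φ} → AllVars V φ → AllVars V (AG φ)
AG-vars h = (h , h) , h

TwoMarked-vars : ∀ {V : Pred AP 0ℓ} {x y} → V x → V y → AllVars V (TwoMarked x y)
TwoMarked-vars {x = x} {y} vx vy =
  conj-vars {φ = EF (conj (prop x) (prop y))} {EF (conj (prop x) (neg (prop y)))}
            (EF-vars {φ = conj (prop x) (prop y)} (vx , vy))
            (EF-vars {φ = conj (prop x) (neg (prop y))} (vx , vy))

varBound : Form → ℕ
varBound (prop a)     = suc a
varBound (neg φ)      = varBound φ
varBound (or φ ψ)     = varBound φ ⊔ varBound ψ
varBound (exists p φ) = suc p ⊔ varBound φ
varBound (EU φ ψ)     = varBound φ ⊔ varBound ψ
varBound (AU φ ψ)     = varBound φ ⊔ varBound ψ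
varBound (EX φ)       = varBound φ
varBound (AX φ)       = varBound φ

varBound-sound : ∀ φ → AllVars (_< varBound φ) φ
varBound-sound φ = go φ ≤-refl
  where
    go : ∀ φ {n} → varBound φ ≤ n → AllVars (_< n) φ
    go (prop a)     h = h
    go (neg φ)      h = go φ h
    go (or φ ψ)     h = go φ (m⊔n≤o⇒m≤o _ _ h) , go ψ (m⊔n≤o⇒n≤o _ _ h)
    go (exists p φ) h = m⊔n≤o⇒m≤o (suc p) (varBound φ) h , go φ (m⊔n≤o⇒n≤o (suc p) (varBound φ) h)
    go (EU φ ψ)     h = go φ (m⊔n≤o⇒m≤o _ _ h) , go ψ (m⊔n≤o⇒n≤o _ _ h)
    go (AU φ ψ)     h = go φ (m⊔n≤o⇒m≤o _ _ h) , go ψ (m⊔n≤o⇒n≤o _ _ h)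
    go (EX φ)       h = go φ h
    go (AX φ)       h = go φ h

-- (true , p) stands for ∃p and (false , p) for ∀p.
Prefix : Set
Prefix = List (Bool × AP)

quantify : Prefix → Form → Form
quantify []                m = m
quantify ((true  , p) ∷ P) m = exists p (quantify P m)
quantify ((false , p) ∷ P) m = forall' p (quantify P m)

quantify-EQCTL : ∀ P {m} → IsCTL m → IsEQCTL (quantify P m)
quantify-EQCTL []                h = ctl h
quantify-EQCTL ((true  , p) ∷ P) h = ex p (quantify-EQCTL P h)
quantify-EQCTL ((false , p) ∷ P) h = all p (quantify-EQCTL P h)

quantify-++ : ∀ P P′ m → quantify (P ++ P′) m ≡ quantify P (quantify P′ m)
quantify-++ []                P′ m = refl
quantify-++ ((true  , p) ∷ P) P′ m = cong (exists p) (quantify-++ P P′ m)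
quantify-++ ((false , p) ∷ P) P′ m = cong (forall' p) (quantify-++ P P′ m)

dual : Prefix → Prefix
dual []                = []
dual ((true  , p) ∷ P) = (false , p) ∷ dual P
dual ((false , p) ∷ P) = (true  , p) ∷ dual P

-- The prefix of a conjunction of two prenex formulas: ¬(¬A ∨ ¬B).
conjPrefix : Prefix → Prefix → Prefix
conjPrefix P P′ = dual (dual P ++ dual P′)

PrefixVars : Pred AP 0ℓ → Prefix → Set
PrefixVars V = All (V ∘ proj₂)

PrefixVars-map : ∀ {V W : Pred AP 0ℓ} → V ⊆ W → ∀ {P} → PrefixVars V P → PrefixVars W P
PrefixVars-map f = All.map f

PrefixVars-dual : ∀ {V : Pred AP 0ℓ} P → PrefixVars V P → PrefixVars V (dual P)
PrefixVars-dual []                []       = []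
PrefixVars-dual ((true  , p) ∷ P) (v ∷ vs) = v ∷ PrefixVars-dual P vs
PrefixVars-dual ((false , p) ∷ P) (v ∷ vs) = v ∷ PrefixVars-dual P vs

PrefixVars-conj : ∀ {V : Pred AP 0ℓ} P P′ → PrefixVars V P → PrefixVars V P′ →
                  PrefixVars V (conjPrefix P P′)
PrefixVars-conj P P′ vs vs′ =
  PrefixVars-dual (dual P ++ dual P′) (++⁺ (PrefixVars-dual P vs) (PrefixVars-dual P′ vs′))

quantify-vars : ∀ {V : Pred AP 0ℓ} P {m} → PrefixVars V P → AllVars V m → AllVars V (quantify P m)
quantify-vars []                []       h = h
quantify-vars ((true  , p) ∷ P) (v ∷ vs) h = v , quantify-vars P vs h
quantify-vars ((false , p) ∷ P) (v ∷ vs) h = v , quantify-vars P vs h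

dual-vars : ∀ {V : Pred AP 0ℓ} P m → AllVars V (quantify P m) → AllVars V (quantify (dual P) (neg m))
dual-vars []                m h       = h
dual-vars ((true  , p) ∷ P) m (v , h) = v , dual-vars P m h
dual-vars ((false , p) ∷ P) m (v , h) = v , dual-vars P m h

FreshFor : Prefix → Form → Set
FreshFor P φ = All (λ bp → AllVars (_≢ proj₂ bp) φ) P

fresh-by-separation : ∀ {V W : Pred AP 0ℓ} P φ → PrefixVars V P → AllVars W φ →
                      (∀ {v} → V v → W v → ⊥) → FreshFor P φ
fresh-by-separation []      φ []       hφ disj = []
fresh-by-separation (_ ∷ P) φ (v ∷ vs) hφ disj =
  AllVars-map (λ w e → disj v (subst _ e w)) φ hφ ∷ fresh-by-separation P φ vs hφ disj

FreshFor-dual : ∀ P P′ m → FreshFor P (quantify P′ m) → FreshFor (dual P) (quantify (dual P′) (neg m))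
FreshFor-dual P P′ m fr = PrefixVars-dual P (All.map (dual-vars P′ m) fr)

record Prenex : Set where
  constructor prenex
  field
    prefix : Prefix
    matrix : Form
    next   : ℕ     -- no variable from `next` on occurs
open Prenex public

⌊_⌋ : Prenex → Form
⌊ r ⌋ = quantify (prefix r) (matrix r)

plain : Form → ℕ → Prenex
plain m n = prenex [] m n

negP : Prenex → Prenex
negP r = prenex (dual (prefix r)) (neg (matrix r)) (next r)

orP : Prenex → Prenex → Prenex
orP r s = prenex (prefix r ++ prefix s) (or (matrix r) (matrix s)) (next s)

conjP : Prenex → Prenex → Prenex
conjP r s = prenex (conjPrefix (prefix r) (prefix s)) (conj (matrix r) (matrix s)) (next s)

existsP : AP → Prenex → Prenex
existsP k r = prenex ((true , k) ∷ prefix r) (matrix r) (next r)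

-- AG (w → Q. m)  becomes  ∀x ∃y Q. (TwoMarked x y ∨ AG (x ∧ w → m))  with fresh x, y = x+1:
-- either x marks two reachable states, or x marks at most one state, and
-- then the quantifiers Q can be chosen for that single state.
guardPrefix : AP → Prefix → Prefix
guardPrefix x P = (false , x) ∷ (true , suc x) ∷ P

guardMatrix : AP → Form → Form → Form
guardMatrix x w m = or (TwoMarked x (suc x)) (AG (impl (conj (prop x) w) m))

guardMatrix-CTL : ∀ x {w m} → IsCTL w → IsCTL m → IsCTL (guardMatrix x w m)
guardMatrix-CTL x hw hm = or (TwoMarked-CTL x (suc x)) (AG-CTL (or (neg (conj-CTL (prop x) hw)) hm))

guardP : AP → Prenex → Prenex
guardP z r = prenex (guardPrefix (next r) (prefix r)) (guardMatrix (next r) (prop z) (matrix r))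
                    (suc (suc (next r)))

Marked : Op → AP → AP → Form → Form → Form
Marked o z₁ z₂ A B =
  conj (conj (AG (impl (prop z₁) A)) (AG (impl (prop z₂) B))) (apply o (prop z₁) (prop z₂))

opP : Op → AP → Prenex → Prenex → Prenex
opP o k r s =
  existsP k (existsP (suc k) (conjP (conjP g₁ g₂) (plain (apply o (prop k) (prop (suc k))) (next g₂))))
  where
    g₁ = guardP k r
    g₂ = guardP (suc k) s

_[_↦_] : (AP → AP) → AP → AP → AP → AP
(σ [ p ↦ k ]) a with a ≟ p
... | yes _ = k
... | no  _ = σ a

-- translate σ k φ: a prenex form of φ renamed by σ, whose bound variables are
-- taken from k on.  Unary operators are treated as binary ones whose second
-- argument is ignored.
mutual
  translate : (AP → AP) → ℕ → Form → Prenex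
  translate σ k (prop a)     = plain (prop (σ a)) k
  translate σ k (neg φ)      = negP (translate σ k φ)
  translate σ k (or φ ψ)     = orP r (translate σ (next r) ψ)
    where r = translate σ k φ
  translate σ k (exists p φ) = existsP k (translate (σ [ p ↦ k ]) (suc k) φ)
  translate σ k (EU φ ψ)     = translateOp σ k opEU φ ψ
  translate σ k (AU φ ψ)     = translateOp σ k opAU φ ψ
  translate σ k (EX φ)       = translateOp σ k opEX φ φ
  translate σ k (AX φ)       = translateOp σ k opAX φ φ

  translateOp : (AP → AP) → ℕ → Op → Form → Form → Prenex
  translateOp σ k o φ ψ = opP o k r (translate σ (next (guardP k r)) ψ)
    where r = translate σ (suc (suc k)) φ

InRange : ℕ → ℕ → Pred AP 0ℓ
InRange lo hi v = lo ≤ v × v < hi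

InRange-widen : ∀ {lo lo′ hi hi′} → lo′ ≤ lo → hi ≤ hi′ → InRange lo hi ⊆ InRange lo′ hi′
InRange-widen l h (lo≤v , v<hi) = ≤-trans l lo≤v , ≤-trans v<hi h

∪-widen : ∀ {V : Pred AP 0ℓ} {lo lo′ hi hi′} → lo′ ≤ lo → hi ≤ hi′ →
          V ∪ InRange lo hi ⊆ V ∪ InRange lo′ hi′
∪-widen l h = Sum.map₂ (InRange-widen l h)

record Scoped (V : Pred AP 0ℓ) (lo : ℕ) (r : Prenex) : Set where
  field
    lo≤next   : lo ≤ next r
    prefix-in : PrefixVars (InRange lo (next r)) (prefix r)
    matrix-in : AllVars (V ∪ InRange lo (next r)) (matrix r)
open Scoped public

-- The combinators preserve scoping.  Their fresh variables are taken at the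
-- bottom (existsP) or at the top (guardP) of the range; the markers of opP
-- become external variables of its arguments.
scoped-weaken : ∀ {V W : Pred AP 0ℓ} {lo r} → V ⊆ W → Scoped V lo r → Scoped W lo r
scoped-weaken {r = r} V⊆W sr = record
  { lo≤next = lo≤next sr ; prefix-in = prefix-in sr
  ; matrix-in = AllVars-map (Sum.map₁ V⊆W) (matrix r) (matrix-in sr) }

plain-scoped : ∀ {V : Pred AP 0ℓ} {m} n → AllVars V m → Scoped V n (plain m n)
plain-scoped {m = m} n h =
  record { lo≤next = ≤-refl ; prefix-in = [] ; matrix-in = AllVars-map inj₁ m h }

negP-scoped : ∀ {V : Pred AP 0ℓ} {lo r} → Scoped V lo r → Scoped V lo (negP r)
negP-scoped sr = record
  { lo≤next = lo≤next sr ; prefix-in = PrefixVars-dual _ (prefix-in sr) ; matrix-in = matrix-in sr }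

orP-scoped : ∀ {V : Pred AP 0ℓ} {lo r s} → Scoped V lo r → Scoped V (next r) s → Scoped V lo (orP r s)
orP-scoped {V} {r = r} {s} sr ss = record
  { lo≤next   = ≤-trans (lo≤next sr) (lo≤next ss)
  ; prefix-in = ++⁺ (PrefixVars-map (InRange-widen ≤-refl (lo≤next ss)) (prefix-in sr))
                    (PrefixVars-map (InRange-widen (lo≤next sr) ≤-refl) (prefix-in ss))
  ; matrix-in = AllVars-map (∪-widen {V} ≤-refl (lo≤next ss)) (matrix r) (matrix-in sr)
              , AllVars-map (∪-widen {V} (lo≤next sr) ≤-refl) (matrix s) (matrix-in ss) }

conjP-scoped : ∀ {V : Pred AP 0ℓ} {lo r s} → Scoped V lo r → Scoped V (next r) s → Scoped V lo (conjP r s)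
conjP-scoped {r = r} {s} sr ss = record
  { lo≤next   = lo≤next sor
  ; prefix-in = PrefixVars-conj (prefix r) (prefix s)
                  (PrefixVars-map (InRange-widen ≤-refl (lo≤next ss)) (prefix-in sr))
                  (PrefixVars-map (InRange-widen (lo≤next sr) ≤-refl) (prefix-in ss))
  ; matrix-in = matrix-in sor }
  where sor = orP-scoped sr ss

existsP-scoped : ∀ {V : Pred AP 0ℓ} {k r} → Scoped (V ∪ ｛ k ｝) (suc k) r → Scoped V k (existsP k r)
existsP-scoped {V} {k} {r} sr = record
  { lo≤next   = k≤next
  ; prefix-in = (≤-refl , lo≤next sr) ∷ PrefixVars-map (InRange-widen (n≤1+n k) ≤-refl) (prefix-in sr)
  ; matrix-in = AllVars-map absorb (matrix r) (matrix-in sr) }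
  where
    k≤next = ≤-trans (n≤1+n k) (lo≤next sr)
    absorb : (V ∪ ｛ k ｝) ∪ InRange (suc k) (next r) ⊆ V ∪ InRange k (next r)
    absorb (inj₁ (inj₁ v))    = inj₁ v
    absorb (inj₁ (inj₂ refl)) = inj₂ (≤-refl , lo≤next sr)
    absorb (inj₂ v∈)          = inj₂ (InRange-widen (n≤1+n k) ≤-refl v∈)

guardP-scoped : ∀ {V : Pred AP 0ℓ} {lo z r} → V z → Scoped V lo r → Scoped V lo (guardP z r)
guardP-scoped {V} {lo} {z} {r} vz sr = record
  { lo≤next   = ≤-trans lo≤x (x≤2+x)
  ; prefix-in = x∈ ∷ 1+x∈ ∷ PrefixVars-map (InRange-widen ≤-refl x≤2+x) (prefix-in sr)
  ; matrix-in = TwoMarked-vars {V ∪ InRange lo (suc (suc x))} (inj₂ x∈) (inj₂ 1+x∈)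
              , AG-vars {V ∪ InRange lo (suc (suc x))} {φ = impl (conj (prop x) (prop z)) (matrix r)}
                  ((inj₂ x∈ , inj₁ vz) , AllVars-map (∪-widen {V} ≤-refl x≤2+x) (matrix r) (matrix-in sr)) }
  where
    x = next r
    lo≤x = lo≤next sr
    x≤2+x = ≤-trans (n≤1+n x) (n≤1+n (suc x))
    x∈ : InRange lo (suc (suc x)) x
    x∈ = lo≤x , m<n⇒m<1+n (n<1+n x)
    1+x∈ : InRange lo (suc (suc x)) (suc x)
    1+x∈ = ≤-trans lo≤x (n≤1+n x) , n<1+n (suc x)

opP-scoped : ∀ {V : Pred AP 0ℓ} o {k r s} → Scoped V (suc (suc k)) r → Scoped V (next (guardP k r)) s →
             Scoped V k (opP o k r s)
opP-scoped {V} o {k} sr ss =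
  existsP-scoped (existsP-scoped
    (conjP-scoped (conjP-scoped (guardP-scoped (inj₁ (inj₂ refl)) (scoped-weaken (inj₁ ∘ inj₁) sr))
                                (guardP-scoped (inj₂ refl) (scoped-weaken (inj₁ ∘ inj₁) ss)))
                  (plain-scoped {(V ∪ ｛ k ｝) ∪ ｛ suc k ｝} _
                     (apply-vars o (inj₁ (inj₂ refl)) (inj₂ refl)))))

⌊⌋-vars : ∀ {V : Pred AP 0ℓ} {lo r} → Scoped V lo r → AllVars (V ∪ InRange lo (next r)) ⌊ r ⌋
⌊⌋-vars {r = r} sr = quantify-vars (prefix r) (PrefixVars-map inj₂ (prefix-in sr)) (matrix-in sr)

markers-below : ∀ {V : Pred AP 0ℓ} {k} → V ⊆ (_< k) → (V ∪ ｛ k ｝) ∪ ｛ suc k ｝ ⊆ (_< suc (suc k))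
markers-below V<k (inj₁ (inj₁ v))    = m<n⇒m<1+n (m<n⇒m<1+n (V<k v))
markers-below V<k (inj₁ (inj₂ refl)) = m<n⇒m<1+n (n<1+n _)
markers-below V<k (inj₂ refl)        = n<1+n _

avoids-markers : ∀ {V : Pred AP 0ℓ} {k lo t} → V ⊆ (_< k) → suc (suc k) ≤ lo → Scoped V lo t →
                 AllVars ((_≢ k) ∩ (_≢ suc k)) ⌊ t ⌋
avoids-markers {V} {k} {lo} {t} V<k 2+k≤lo st = AllVars-map below-or-above ⌊ t ⌋ (⌊⌋-vars st)
  where
    below-or-above : V ∪ InRange lo (next t) ⊆ (_≢ k) ∩ (_≢ suc k)
    below-or-above (inj₁ v)          = <⇒≢ (V<k v) , <⇒≢ (m<n⇒m<1+n (V<k v))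
    below-or-above (inj₂ (lo≤v , _)) =
      >⇒≢ (<-≤-trans (m<n⇒m<1+n (n<1+n k)) (≤-trans 2+k≤lo lo≤v)) , >⇒≢ (≤-trans 2+k≤lo lo≤v)

separated : ∀ {V : Pred AP 0ℓ} {lo r s} → Scoped V lo r → Scoped V (next r) s → V ⊆ (_< lo) →
            FreshFor (prefix r) ⌊ s ⌋ × FreshFor (prefix s) (matrix r)
separated {V} {lo} {r} {s} sr ss V<lo =
  fresh-by-separation (prefix r) ⌊ s ⌋ (prefix-in sr) (⌊⌋-vars ss) disjoint₁ ,
  fresh-by-separation (prefix s) (matrix r) (prefix-in ss) (matrix-in sr) disjoint₂
  where
    disjoint₁ : ∀ {v} → InRange lo (next r) v → (V ∪ InRange (next r) (next s)) v → ⊥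
    disjoint₁ (lo≤v , _)   (inj₁ v∈V)        = <⇒≱ (V<lo v∈V) lo≤v
    disjoint₁ (_    , v<r) (inj₂ (r≤v , _))  = <⇒≱ v<r r≤v
    disjoint₂ : ∀ {v} → InRange (next r) (next s) v → (V ∪ InRange lo (next r)) v → ⊥
    disjoint₂ (r≤v , _) (inj₁ v∈V)       = <⇒≱ (<-≤-trans (V<lo v∈V) (lo≤next sr)) r≤v
    disjoint₂ (r≤v , _) (inj₂ (_ , v<r)) = <⇒≱ v<r r≤v

scoped-bounded : ∀ {V : Pred AP 0ℓ} {lo r} → Scoped V lo r → V ⊆ (_< lo) →
                 PrefixVars (_< next r) (prefix r) × AllVars (_< next r) (matrix r)
scoped-bounded {r = r} sr V<lo =
  PrefixVars-map proj₂ (prefix-in sr) ,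
  AllVars-map [ (λ v → <-≤-trans (V<lo v) (lo≤next sr)) , proj₂ ] (matrix r) (matrix-in sr)

mutual
  translate-scoped : ∀ {V : Pred AP 0ℓ} σ k φ → AllVars (V ∘ σ) φ → Scoped V k (translate σ k φ)
  translate-scoped σ k (prop a)     h         = plain-scoped k h
  translate-scoped σ k (neg φ)      h         = negP-scoped (translate-scoped σ k φ h)
  translate-scoped σ k (or φ ψ)     (hφ , hψ) =
    orP-scoped (translate-scoped σ k φ hφ) (translate-scoped σ _ ψ hψ)
  translate-scoped {V} σ k (exists p φ) (_ , h) =
    existsP-scoped (translate-scoped (σ [ p ↦ k ]) (suc k) φ (AllVars-map renamed φ h))
    where
      renamed : ∀ {a} → V (σ a) → (V ∪ ｛ k ｝) ((σ [ p ↦ k ]) a)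
      renamed {a} v with a ≟ p
      ... | yes _ = inj₂ refl
      ... | no  _ = inj₁ v
  translate-scoped σ k (EU φ ψ) (hφ , hψ) = translateOp-scoped σ k opEU φ ψ hφ hψ
  translate-scoped σ k (AU φ ψ) (hφ , hψ) = translateOp-scoped σ k opAU φ ψ hφ hψ
  translate-scoped σ k (EX φ)   h         = translateOp-scoped σ k opEX φ φ h h
  translate-scoped σ k (AX φ)   h         = translateOp-scoped σ k opAX φ φ h h

  translateOp-scoped : ∀ {V : Pred AP 0ℓ} σ k o φ ψ → AllVars (V ∘ σ) φ → AllVars (V ∘ σ) ψ →
                       Scoped V k (translateOp σ k o φ ψ)
  translateOp-scoped σ k o φ ψ hφ hψ =
    opP-scoped o (translate-scoped σ _ φ hφ) (translate-scoped σ _ ψ hψ)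

mutual
  translate-CTL : ∀ σ k φ → IsCTL (matrix (translate σ k φ))
  translate-CTL σ k (prop a)     = prop (σ a)
  translate-CTL σ k (neg φ)      = neg (translate-CTL σ k φ)
  translate-CTL σ k (or φ ψ)     = or (translate-CTL σ k φ) (translate-CTL σ _ ψ)
  translate-CTL σ k (exists p φ) = translate-CTL _ _ φ
  translate-CTL σ k (EU φ ψ)     = translateOp-CTL σ k opEU φ ψ
  translate-CTL σ k (AU φ ψ)     = translateOp-CTL σ k opAU φ ψ
  translate-CTL σ k (EX φ)       = translateOp-CTL σ k opEX φ φ
  translate-CTL σ k (AX φ)       = translateOp-CTL σ k opAX φ φ

  translateOp-CTL : ∀ σ k o φ ψ → IsCTL (matrix (translateOp σ k o φ ψ))
  translateOp-CTL σ k o φ ψ =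
    conj-CTL (conj-CTL (guardMatrix-CTL _ (prop k) (translate-CTL σ _ φ))
                       (guardMatrix-CTL _ (prop (suc k)) (translate-CTL σ _ ψ)))
             (apply-CTL o (prop k) (prop (suc k)))

open Equivalence using (to; from)
module ⇔ = IsEquivalence (⇔-isEquivalence {0ℓ})

infixr 4 _⨾_
_⨾_ : ∀ {A B C : Set} → A ⇔ B → B ⇔ C → A ⇔ C
_⨾_ = ⇔.trans

module Semantics (em : ExcludedMiddle 0ℓ) {Q : Set} (R : Q → Q → Set) where

  dne : DoubleNegationElimination 0ℓ
  dne = em⇒dne em

  Labelling : Set
  Labelling = Q → AP → Bool

  sat : Labelling → Q → Form → Set
  sat = satL R

  Outside : AP → Labelling → Labelling → Set
  Outside p ℓ′ ℓ = ∀ r a → a ≢ p → ℓ′ r a ≡ ℓ r a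

  _[_≔_] : Labelling → AP → (Q → Bool) → Labelling
  (ℓ [ p ≔ f ]) r a with a ≟ p
  ... | yes _ = f r
  ... | no  _ = ℓ r a

  ≔-hit : ∀ ℓ p f r → (ℓ [ p ≔ f ]) r p ≡ f r
  ≔-hit ℓ p f r with p ≟ p
  ... | yes _  = refl
  ... | no p≢p = ⊥-elim (p≢p refl)

  ≔-outside : ∀ ℓ p f → Outside p (ℓ [ p ≔ f ]) ℓ
  ≔-outside ℓ p f r a a≢p with a ≟ p
  ... | yes a≡p = ⊥-elim (a≢p a≡p)
  ... | no  _   = refl

  T-≔-hit : ∀ ℓ p f r → T ((ℓ [ p ≔ f ]) r p) ⇔ T (f r)
  T-≔-hit ℓ p f r = mk⇔ (subst T (≔-hit ℓ p f r)) (subst T (sym (≔-hit ℓ p f r)))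

  T-≔-outside : ∀ ℓ p f r {a} → a ≢ p → T ((ℓ [ p ≔ f ]) r a) ⇔ T (ℓ r a)
  T-≔-outside ℓ p f r {a} a≢p =
    mk⇔ (subst T (≔-outside ℓ p f r a a≢p)) (subst T (sym (≔-outside ℓ p f r a a≢p)))

  ⌜_⌝ : (Q → Set) → Q → Bool
  ⌜ P ⌝ r = isYes (em {P r})

  T-⌜⌝ : ∀ P r → T (⌜ P ⌝ r) ⇔ P r
  T-⌜⌝ P r = mk⇔ (toWitness {a? = em}) (fromWitness {a? = em})

  Agree : Pred AP 0ℓ → Labelling → Labelling → Set
  Agree V ℓ₁ ℓ₂ = ∀ r {a} → V a → ℓ₁ r a ≡ ℓ₂ r a

  Agree-update : ∀ {V ℓ₁ ℓ₁′ ℓ₂} p → Outside p ℓ₁′ ℓ₁ → Agree V ℓ₁ ℓ₂ →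
                 Agree V ℓ₁′ (ℓ₂ [ p ≔ (λ r → ℓ₁′ r p) ])
  Agree-update p out ag r {a} v with a ≟ p
  ... | yes refl = refl
  ... | no  a≢p  = trans (out r a a≢p) (ag r v)

  -- The coincidence lemma; under ∃p the witness labelling is transferred by relabelling p.
  coincidence→ : ∀ {V} φ {ℓ₁ ℓ₂} → AllVars V φ → Agree V ℓ₁ ℓ₂ → ∀ q → sat ℓ₁ q φ → sat ℓ₂ q φ
  coincidence→ (prop p) v ag q h = subst T (ag q v) h
  coincidence→ (neg φ) v ag q h h₂ = h (coincidence→ φ v (λ r x → sym (ag r x)) q h₂)
  coincidence→ (or φ ψ) (vφ , vψ) ag q (inj₁ h) = inj₁ (coincidence→ φ vφ ag q h)
  coincidence→ (or φ ψ) (vφ , vψ) ag q (inj₂ h) = inj₂ (coincidence→ ψ vψ ag q h)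
  coincidence→ (exists p φ) {ℓ₂ = ℓ₂} (_ , v) ag q (ℓ₁′ , out , h) =
    ℓ₂ [ p ≔ (λ r → ℓ₁′ r p) ] , ≔-outside ℓ₂ p _ , coincidence→ φ v (Agree-update p out ag) q h
  coincidence→ (EU φ ψ) (vφ , vψ) ag q (π , i , h , hs) =
    π , i , coincidence→ ψ vψ ag _ h , λ j j<i → coincidence→ φ vφ ag _ (hs j j<i)
  coincidence→ (AU φ ψ) (vφ , vψ) ag q h π with h π
  ... | i , hψ , hs = i , coincidence→ ψ vψ ag _ hψ , λ j j<i → coincidence→ φ vφ ag _ (hs j j<i)
  coincidence→ (EX φ) v ag q (π , h) = π , coincidence→ φ v ag _ h
  coincidence→ (AX φ) v ag q h π = coincidence→ φ v ag _ (h π)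

  coincidence : ∀ {V} φ {ℓ₁ ℓ₂} → AllVars V φ → Agree V ℓ₁ ℓ₂ → ∀ q → sat ℓ₁ q φ ⇔ sat ℓ₂ q φ
  coincidence φ v ag q = mk⇔ (coincidence→ φ v ag q) (coincidence→ φ v (λ r x → sym (ag r x)) q)

  coincidence-outside : ∀ φ p {ℓ₁ ℓ₂} → AllVars (_≢ p) φ → Outside p ℓ₁ ℓ₂ →
                        ∀ q → sat ℓ₁ q φ ⇔ sat ℓ₂ q φ
  coincidence-outside φ p v out = coincidence φ v (λ r {a} → out r a)

  excluded : ∀ {ℓ q} φ → sat ℓ q (or φ (neg φ))
  excluded {ℓ} {q} φ with em {sat ℓ q φ}
  ... | yes h = inj₁ h
  ... | no ¬h = inj₂ ¬h

  conj-intro : ∀ {ℓ q} φ ψ → sat ℓ q φ → sat ℓ q ψ → sat ℓ q (conj φ ψ)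
  conj-intro φ ψ hφ hψ (inj₁ ¬hφ) = ¬hφ hφ
  conj-intro φ ψ hφ hψ (inj₂ ¬hψ) = ¬hψ hψ

  conj-elim₁ : ∀ {ℓ q} φ ψ → sat ℓ q (conj φ ψ) → sat ℓ q φ
  conj-elim₁ φ ψ h = dne (λ ¬hφ → h (inj₁ ¬hφ))

  conj-elim₂ : ∀ {ℓ q} φ ψ → sat ℓ q (conj φ ψ) → sat ℓ q ψ
  conj-elim₂ φ ψ h = dne (λ ¬hψ → h (inj₂ ¬hψ))

  impl-intro : ∀ {ℓ q} φ ψ → (sat ℓ q φ → sat ℓ q ψ) → sat ℓ q (impl φ ψ)
  impl-intro {ℓ} {q} φ ψ f with em {sat ℓ q φ}
  ... | yes hφ = inj₂ (f hφ)
  ... | no ¬hφ = inj₁ ¬hφ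

  impl-elim : ∀ {ℓ q} φ ψ → sat ℓ q (impl φ ψ) → sat ℓ q φ → sat ℓ q ψ
  impl-elim φ ψ (inj₁ ¬hφ) hφ = ⊥-elim (¬hφ hφ)
  impl-elim φ ψ (inj₂ hψ)  hφ = hψ

  AG-intro : ∀ {ℓ q} φ → (∀ (π : Path R q) i → sat ℓ (ρ π i) φ) → sat ℓ q (AG φ)
  AG-intro φ f (π , i , ¬hφ , _) = ¬hφ (f π i)

  AG-elim : ∀ {ℓ q} φ → sat ℓ q (AG φ) → ∀ (π : Path R q) i → sat ℓ (ρ π i) φ
  AG-elim φ h π i = dne (λ ¬hφ → h (π , i , ¬hφ , λ j _ → excluded φ))

  EF-intro : ∀ {ℓ q} φ (π : Path R q) i → sat ℓ (ρ π i) φ → sat ℓ q (EF φ)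
  EF-intro φ π i h = π , i , h , λ j _ → excluded φ

  forall-intro : ∀ {ℓ q} p φ → (∀ ℓ′ → Outside p ℓ′ ℓ → sat ℓ′ q φ) → sat ℓ q (forall' p φ)
  forall-intro p φ f (ℓ′ , out , ¬h) = ¬h (f ℓ′ out)

  forall-elim : ∀ {ℓ q} p φ → sat ℓ q (forall' p φ) → ∀ ℓ′ → Outside p ℓ′ ℓ → sat ℓ′ q φ
  forall-elim p φ h ℓ′ out = dne (λ ¬h → h (ℓ′ , out , ¬h))

  conj-cong : ∀ {ℓ q} {φ φ′ ψ ψ′} → sat ℓ q φ ⇔ sat ℓ q φ′ → sat ℓ q ψ ⇔ sat ℓ q ψ′ →
              sat ℓ q (conj φ ψ) ⇔ sat ℓ q (conj φ′ ψ′)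
  conj-cong eφ eψ = ¬-cong-⇔ (¬-cong-⇔ eφ ⊎-⇔ ¬-cong-⇔ eψ)

  apply-mono : ∀ o {φ ψ φ′ ψ′ ℓ ℓ′ q} →
               (∀ (π : Path R q) i → sat ℓ (ρ π i) φ → sat ℓ′ (ρ π i) φ′) →
               (∀ (π : Path R q) i → sat ℓ (ρ π i) ψ → sat ℓ′ (ρ π i) ψ′) →
               sat ℓ q (apply o φ ψ) → sat ℓ′ q (apply o φ′ ψ′)
  apply-mono opEX fφ fψ (π , h) = π , fφ π 1 h
  apply-mono opAX fφ fψ h π = fφ π 1 (h π)
  apply-mono opEU fφ fψ (π , i , hψ , hφ) = π , i , fψ π i hψ , λ j j<i → fφ π j (hφ j j<i)
  apply-mono opAU fφ fψ h π with h π
  ... | i , hψ , hφ = i , fψ π i hψ , λ j j<i → fφ π j (hφ j j<i)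

  apply-cong : ∀ o {φ ψ φ′ ψ′ ℓ ℓ′ q} →
               (∀ r → sat ℓ r φ ⇔ sat ℓ′ r φ′) → (∀ r → sat ℓ r ψ ⇔ sat ℓ′ r ψ′) →
               sat ℓ q (apply o φ ψ) ⇔ sat ℓ′ q (apply o φ′ ψ′)
  apply-cong o eφ eψ = mk⇔ (apply-mono o (λ π i → to (eφ _)) (λ π i → to (eψ _)))
                           (apply-mono o (λ π i → from (eφ _)) (λ π i → from (eψ _)))

  Equivalent : Form → Form → Set
  Equivalent φ ψ = ∀ ℓ q → sat ℓ q φ ⇔ sat ℓ q ψ

  quantify-cong : ∀ P {φ ψ} → Equivalent φ ψ → Equivalent (quantify P φ) (quantify P ψ)
  quantify-cong []                e = e
  quantify-cong ((true  , p) ∷ P) e ℓ q =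
    mk⇔ (λ (ℓ′ , out , h) → ℓ′ , out , to   (quantify-cong P e ℓ′ q) h)
        (λ (ℓ′ , out , h) → ℓ′ , out , from (quantify-cong P e ℓ′ q) h)
  quantify-cong ((false , p) ∷ P) e ℓ q =
    mk⇔ (λ h (ℓ′ , out , ¬h) → h (ℓ′ , out , ¬h ∘ to   (quantify-cong P e ℓ′ q)))
        (λ h (ℓ′ , out , ¬h) → h (ℓ′ , out , ¬h ∘ from (quantify-cong P e ℓ′ q)))

  quantify-dual : ∀ P m ℓ q → sat ℓ q (quantify (dual P) (neg m)) ⇔ (¬ sat ℓ q (quantify P m))
  quantify-dual []                m ℓ q = ⇔.refl
  quantify-dual ((true  , p) ∷ P) m ℓ q =
    mk⇔ (λ h (ℓ′ , out , e) → h (ℓ′ , out , λ d → to (quantify-dual P m ℓ′ q) d e))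
        (λ h (ℓ′ , out , ¬d) → ¬d (from (quantify-dual P m ℓ′ q) (λ e → h (ℓ′ , out , e))))
  quantify-dual ((false , p) ∷ P) m ℓ q =
    mk⇔ (λ (ℓ′ , out , d) h → h (ℓ′ , out , to (quantify-dual P m ℓ′ q) d))
        (λ h → let ℓ′ , out , ¬e = dne {sat ℓ q (exists p (neg (quantify P m)))} h
               in ℓ′ , out , from (quantify-dual P m ℓ′ q) ¬e)

  pull-or-left : ∀ P m ψ ℓ q → FreshFor P ψ →
                 sat ℓ q (or (quantify P m) ψ) ⇔ sat ℓ q (quantify P (or m ψ))
  pull-or-left [] m ψ ℓ q [] = ⇔.refl
  pull-or-left ((true , p) ∷ P) m ψ ℓ q (fr ∷ frs) = mk⇔ forth back
    where
      IH : ∀ ℓ′ → sat ℓ′ q (or (quantify P m) ψ) ⇔ sat ℓ′ q (quantify P (or m ψ))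
      IH ℓ′ = pull-or-left P m ψ ℓ′ q frs
      forth : sat ℓ q (or (exists p (quantify P m)) ψ) → sat ℓ q (exists p (quantify P (or m ψ)))
      forth (inj₁ (ℓ′ , out , h)) = ℓ′ , out , to (IH ℓ′) (inj₁ h)
      forth (inj₂ h)              = ℓ , (λ _ _ _ → refl) , to (IH ℓ) (inj₂ h)
      back : sat ℓ q (exists p (quantify P (or m ψ))) → sat ℓ q (or (exists p (quantify P m)) ψ)
      back (ℓ′ , out , h) with from (IH ℓ′) h
      ... | inj₁ h′ = inj₁ (ℓ′ , out , h′)
      ... | inj₂ h′ = inj₂ (to (coincidence-outside ψ p fr out q) h′)
  pull-or-left ((false , p) ∷ P) m ψ ℓ q (fr ∷ frs) = mk⇔ forth back
    where
      IH : ∀ ℓ′ → sat ℓ′ q (or (quantify P m) ψ) ⇔ sat ℓ′ q (quantify P (or m ψ))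
      IH ℓ′ = pull-or-left P m ψ ℓ′ q frs
      forth : sat ℓ q (or (forall' p (quantify P m)) ψ) → sat ℓ q (forall' p (quantify P (or m ψ)))
      forth (inj₁ h) = forall-intro p (quantify P (or m ψ)) λ ℓ′ out →
        to (IH ℓ′) (inj₁ (forall-elim p (quantify P m) h ℓ′ out))
      forth (inj₂ h) = forall-intro p (quantify P (or m ψ)) λ ℓ′ out →
        to (IH ℓ′) (inj₂ (from (coincidence-outside ψ p fr out q) h))
      back : sat ℓ q (forall' p (quantify P (or m ψ))) → sat ℓ q (or (forall' p (quantify P m)) ψ)
      back h with em {sat ℓ q ψ}
      ... | yes hψ = inj₂ hψ
      ... | no ¬hψ = inj₁ (forall-intro p (quantify P m) λ ℓ′ out →
                              left ℓ′ out (from (IH ℓ′) (forall-elim p (quantify P (or m ψ)) h ℓ′ out)))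
        where
          left : ∀ ℓ′ → Outside p ℓ′ ℓ → sat ℓ′ q (or (quantify P m) ψ) → sat ℓ′ q (quantify P m)
          left ℓ′ out (inj₁ h′) = h′
          left ℓ′ out (inj₂ h′) = ⊥-elim (¬hψ (to (coincidence-outside ψ p fr out q) h′))

  or-comm : ∀ φ ψ → Equivalent (or φ ψ) (or ψ φ)
  or-comm φ ψ ℓ q = mk⇔ swap swap

  pull-or-right : ∀ P m φ ℓ q → FreshFor P φ →
                  sat ℓ q (or φ (quantify P m)) ⇔ sat ℓ q (quantify P (or φ m))
  pull-or-right P m φ ℓ q fr =
    or-comm φ (quantify P m) ℓ q ⨾ pull-or-left P m φ ℓ q fr ⨾ quantify-cong P (or-comm m φ) ℓ q

  quantify-or : ∀ P m P′ m′ ℓ q → FreshFor P (quantify P′ m′) → FreshFor P′ m →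
                sat ℓ q (or (quantify P m) (quantify P′ m′)) ⇔ sat ℓ q (quantify (P ++ P′) (or m m′))
  quantify-or P m P′ m′ ℓ q fr fr′ =
    pull-or-left P m (quantify P′ m′) ℓ q fr
    ⨾ quantify-cong P (λ ℓ′ q′ → pull-or-right P′ m′ m ℓ′ q′ fr′) ℓ q
    ⨾ mk⇔ (subst (sat ℓ q) eq) (subst (sat ℓ q) (sym eq))
    where eq = sym (quantify-++ P P′ (or m m′))

  quantify-conj : ∀ P m P′ m′ ℓ q → FreshFor P (quantify P′ m′) → FreshFor P′ m →
                  sat ℓ q (conj (quantify P m) (quantify P′ m′)) ⇔
                  sat ℓ q (quantify (conjPrefix P P′) (conj m m′))
  quantify-conj P m P′ m′ ℓ q fr fr′ =
    ¬-cong-⇔ (⇔.sym (quantify-dual P m ℓ q ⊎-⇔ quantify-dual P′ m′ ℓ q)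
              ⨾ quantify-or (dual P) (neg m) (dual P′) (neg m′) ℓ q
                  (FreshFor-dual P P′ m′ fr) (PrefixVars-dual P′ fr′))
    ⨾ ⇔.sym (quantify-dual (dual P ++ dual P′) (or (neg m) (neg m′)) ℓ q)

  -- Quantifiers under AG, via a variable marking a single state

  marked-unique : ∀ x y ℓ q → x ≢ y → ¬ sat ℓ q (exists y (TwoMarked x y)) →
                  ∀ (π π′ : Path R q) i i′ → T (ℓ (ρ π i) x) → T (ℓ (ρ π′ i′) x) → ρ π′ i′ ≡ ρ π i
  marked-unique x y ℓ q x≢y ¬two π π′ i i′ hx hx′ = dne λ differ →
    ¬two (ℓy , ≔-outside ℓ y _ ,
          conj-intro {ℓy} {q} (EF (conj (prop x) (prop y))) (EF (conj (prop x) (neg (prop y))))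
            (EF-intro {ℓy} (conj (prop x) (prop y)) π i
              (conj-intro {ℓy} (prop x) (prop y) (from (T-≔-outside ℓ y _ s x≢y) hx)
                                                  (from (T-≔-hit ℓ y _ s) (from (T-⌜⌝ (_≡ s) s) refl))))
            (EF-intro {ℓy} (conj (prop x) (neg (prop y))) π′ i′
              (conj-intro {ℓy} (prop x) (neg (prop y))
                 (from (T-≔-outside ℓ y _ _ x≢y) hx′)
                 (differ ∘ to (T-⌜⌝ (_≡ s) _) ∘ to (T-≔-hit ℓ y _ _)))))
    where
      s = ρ π i
      ℓy = ℓ [ y ≔ ⌜ _≡ s ⌝ ]

  single-not-twice : ∀ x y ℓ q s → x ≢ y → (∀ r → T (ℓ r x) → r ≡ s) →
                     ¬ sat ℓ q (exists y (TwoMarked x y))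
  single-not-twice x y ℓ q s x≢y only-s (ℓy , out , two)
    with conj-elim₁ {ℓy} {q} (EF (conj (prop x) (prop y))) (EF (conj (prop x) (neg (prop y)))) two
       | conj-elim₂ {ℓy} {q} (EF (conj (prop x) (prop y))) (EF (conj (prop x) (neg (prop y)))) two
  ... | (π₁ , i₁ , h₁ , _) | (π₂ , i₂ , h₂ , _) =
    conj-elim₂ {ℓy} (prop x) (neg (prop y)) h₂
      (subst (λ r → T (ℓy r y))
             (trans (at-s (conj-elim₁ {ℓy} (prop x) (prop y) h₁))
                    (sym (at-s (conj-elim₁ {ℓy} (prop x) (neg (prop y)) h₂))))
             (conj-elim₂ {ℓy} (prop x) (prop y) h₁))
    where
      at-s : ∀ {r} → T (ℓy r x) → r ≡ s
      at-s {r} t = only-s r (subst T (out r x x≢y) t)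

  -- AG (w → A)  ⇔  ∀x. (∃y. TwoMarked x y) ∨ AG (x ∧ w → A)  for x, y not in w, A:
  -- for ⇐, let x mark exactly the state at which w → A is to be checked.
  AG-single-marker : ∀ x y w A ℓ q → x ≢ y → AllVars (_≢ x) w → AllVars (_≢ x) A →
    sat ℓ q (AG (impl w A)) ⇔
    sat ℓ q (forall' x (or (exists y (TwoMarked x y)) (AG (impl (conj (prop x) w) A))))
  AG-single-marker x y w A ℓ q x≢y w-x A-x = mk⇔ forth back
    where
      v = conj (prop x) w
      Body = or (exists y (TwoMarked x y)) (AG (impl v A))
      forth : sat ℓ q (AG (impl w A)) → sat ℓ q (forall' x Body)
      forth h = forall-intro x Body λ ℓx out → inj₂ (AG-intro (impl v A) λ π i →
        impl-intro v A λ hv →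
          from (coincidence-outside A x A-x out _)
            (impl-elim w A (AG-elim (impl w A) h π i)
              (to (coincidence-outside w x w-x out _) (conj-elim₂ {ℓx} (prop x) w hv))))
      back : sat ℓ q (forall' x Body) → sat ℓ q (AG (impl w A))
      back h = AG-intro (impl w A) λ π i → impl-intro w A (at π i)
        where
          at : ∀ (π : Path R q) i → sat ℓ (ρ π i) w → sat ℓ (ρ π i) A
          at π i hw = cases (forall-elim x Body h ℓx out)
            where
              s = ρ π i
              ℓx = ℓ [ x ≔ ⌜ _≡ s ⌝ ]
              out = ≔-outside ℓ x ⌜ _≡ s ⌝
              only-s : ∀ r → T (ℓx r x) → r ≡ s
              only-s r = to (T-⌜⌝ (_≡ s) r) ∘ to (T-≔-hit ℓ x _ r)
              cases : sat ℓx q Body → sat ℓ s A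
              cases (inj₁ two) = ⊥-elim (single-not-twice x y ℓx q s x≢y only-s two)
              cases (inj₂ ag)  =
                to (coincidence-outside A x A-x out s)
                  (impl-elim v A (AG-elim (impl v A) ag π i)
                    (conj-intro {ℓx} (prop x) w (from (T-≔-hit ℓ x _ s) (from (T-⌜⌝ (_≡ s) s) refl))
                                                (from (coincidence-outside w x w-x out s) hw)))

  -- If x labels at most one reachable state, a prefix Q (not mentioning x, w, y)
  -- commutes with AG (x ∧ w → ·): one choice of the quantified variables serves that state.
  AG-quantify : ∀ x y w P m → x ≢ y → FreshFor P (conj (prop x) w) →
    FreshFor P (exists y (TwoMarked x y)) → ∀ ℓ q → ¬ sat ℓ q (exists y (TwoMarked x y)) →
    sat ℓ q (AG (impl (conj (prop x) w) (quantify P m))) ⇔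
    sat ℓ q (quantify P (AG (impl (conj (prop x) w) m)))
  AG-quantify x y w [] m x≢y _ _ ℓ q _ = ⇔.refl
  AG-quantify x y w ((true , p) ∷ P) m x≢y (fv ∷ fvs) (fu ∷ fus) ℓ q ¬two = mk⇔ forth back
    where
      v = conj (prop x) w
      E = quantify P m
      IH : ∀ ℓp → Outside p ℓp ℓ → sat ℓp q (AG (impl v E)) ⇔ sat ℓp q (quantify P (AG (impl v m)))
      IH ℓp out = AG-quantify x y w P m x≢y fvs fus ℓp q
                    (¬two ∘ to (coincidence-outside (exists y (TwoMarked x y)) p fu out q))
      forth : sat ℓ q (AG (impl v (exists p E))) → sat ℓ q (exists p (quantify P (AG (impl v m))))
      forth h with em {Σ (Path R q) λ π → Σ ℕ λ i → sat ℓ (ρ π i) v}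
      ... | no none = ℓ , (λ _ _ _ → refl) ,
              to (IH ℓ (λ _ _ _ → refl)) (AG-intro (impl v E) λ π i →
                impl-intro v E λ hv → ⊥-elim (none (π , i , hv)))
      ... | yes (π₀ , i₀ , hv₀) with impl-elim v (exists p E) (AG-elim (impl v (exists p E)) h π₀ i₀) hv₀
      ...   | ℓp , out , hE₀ = ℓp , out , to (IH ℓp out) (AG-intro (impl v E) λ π i → impl-intro v E λ hv →
                subst (λ r → sat ℓp r E)
                  (sym (marked-unique x y ℓ q x≢y ¬two π₀ π i₀ i (conj-elim₁ {ℓ} (prop x) w hv₀)
                         (conj-elim₁ {ℓ} (prop x) w (to (coincidence-outside v p fv out _) hv))))
                  hE₀)
      back : sat ℓ q (exists p (quantify P (AG (impl v m)))) → sat ℓ q (AG (impl v (exists p E)))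
      back (ℓp , out , h) = AG-intro (impl v (exists p E)) λ π i → impl-intro v (exists p E) λ hv →
        ℓp , out , impl-elim v E (AG-elim (impl v E) (from (IH ℓp out) h) π i)
                                 (from (coincidence-outside v p fv out _) hv)
  AG-quantify x y w ((false , p) ∷ P) m x≢y (fv ∷ fvs) (fu ∷ fus) ℓ q ¬two = mk⇔ forth back
    where
      v = conj (prop x) w
      E = quantify P m
      IH : ∀ ℓp → Outside p ℓp ℓ → sat ℓp q (AG (impl v E)) ⇔ sat ℓp q (quantify P (AG (impl v m)))
      IH ℓp out = AG-quantify x y w P m x≢y fvs fus ℓp q
                    (¬two ∘ to (coincidence-outside (exists y (TwoMarked x y)) p fu out q))
      forth : sat ℓ q (AG (impl v (forall' p E))) → sat ℓ q (forall' p (quantify P (AG (impl v m))))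
      forth h = forall-intro p (quantify P (AG (impl v m))) λ ℓp out → to (IH ℓp out)
        (AG-intro (impl v E) λ π i → impl-intro v E λ hv →
          forall-elim p E (impl-elim v (forall' p E) (AG-elim (impl v (forall' p E)) h π i)
                                     (to (coincidence-outside v p fv out _) hv)) ℓp out)
      back : sat ℓ q (forall' p (quantify P (AG (impl v m)))) → sat ℓ q (AG (impl v (forall' p E)))
      back h = AG-intro (impl v (forall' p E)) λ π i → impl-intro v (forall' p E) λ hv →
        forall-intro p E λ ℓp out → impl-elim v E
          (AG-elim (impl v E) (from (IH ℓp out) (forall-elim p (quantify P (AG (impl v m))) h ℓp out)) π i)
          (from (coincidence-outside v p fv out _) hv)

  AG-guard : ∀ x w P m ℓ q → AllVars (_< x) w → PrefixVars (_< x) P → AllVars (_< x) m → FreshFor P w →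
    sat ℓ q (AG (impl w (quantify P m))) ⇔ sat ℓ q (quantify (guardPrefix x P) (guardMatrix x w m))
  AG-guard x w P m ℓ q w<x P<x m<x P-w =
    AG-single-marker x y w A ℓ q x≢y (AllVars-map <⇒≢ w w<x)
      (quantify-vars P (PrefixVars-map <⇒≢ P<x) (AllVars-map <⇒≢ m m<x))
    ⨾ quantify-cong ((false , x) ∷ []) {or Two (AG (impl v A))}
                    {quantify ((true , y) ∷ P) (or (TwoMarked x y) M′)} inner ℓ q
    where
      y = suc x
      A = quantify P m
      v = conj (prop x) w
      M′ = AG (impl v m)
      Two = exists y (TwoMarked x y)
      x≢y : x ≢ y
      x≢y = <⇒≢ (n<1+n x)
      P-v : FreshFor P v
      P-v = All.zipWith (λ (p<x , w-p) → >⇒≢ p<x , w-p) (P<x , P-w)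
      P-Two : FreshFor P Two
      P-Two = All.map (λ {(_ , p)} p<x → >⇒≢ (m<n⇒m<1+n p<x) ,
                         TwoMarked-vars {_≢ p} (>⇒≢ p<x) (>⇒≢ (m<n⇒m<1+n p<x))) P<x
      y-M′ : FreshFor ((true , y) ∷ []) (quantify P M′)
      y-M′ = quantify-vars P (PrefixVars-map (<⇒≢ ∘ m<n⇒m<1+n) P<x)
               (AG-vars {φ = impl v m} ((x≢y , AllVars-map (<⇒≢ ∘ m<n⇒m<1+n) w w<x) ,
                                        AllVars-map (<⇒≢ ∘ m<n⇒m<1+n) m m<x)) ∷ []
      commute : Equivalent (or Two (AG (impl v A))) (or Two (quantify P M′))
      commute ℓ′ q′ with em {sat ℓ′ q′ Two}
      ... | yes two = mk⇔ (λ _ → inj₁ two) (λ _ → inj₁ two)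
      ... | no ¬two = ⇔.refl ⊎-⇔ AG-quantify x y w P m x≢y P-v P-Two ℓ′ q′ ¬two
      inner : Equivalent (or Two (AG (impl v A))) (quantify ((true , y) ∷ P) (or (TwoMarked x y) M′))
      inner ℓ′ q′ = commute ℓ′ q′ ⨾ quantify-or ((true , y) ∷ []) (TwoMarked x y) P M′ ℓ′ q′
                                      y-M′ (All.map proj₂ P-Two)

  negP-correct : ∀ r ℓ q → sat ℓ q (neg ⌊ r ⌋) ⇔ sat ℓ q ⌊ negP r ⌋
  negP-correct r ℓ q = ⇔.sym (quantify-dual (prefix r) (matrix r) ℓ q)

  orP-correct : ∀ {V lo r s} → Scoped V lo r → Scoped V (next r) s → V ⊆ (_< lo) → ∀ ℓ q →
                sat ℓ q (or ⌊ r ⌋ ⌊ s ⌋) ⇔ sat ℓ q ⌊ orP r s ⌋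
  orP-correct {r = r} {s} sr ss V<lo ℓ q =
    let r-s , s-r = separated sr ss V<lo
    in quantify-or (prefix r) (matrix r) (prefix s) (matrix s) ℓ q r-s s-r

  conjP-correct : ∀ {V lo r s} → Scoped V lo r → Scoped V (next r) s → V ⊆ (_< lo) → ∀ ℓ q →
                  sat ℓ q (conj ⌊ r ⌋ ⌊ s ⌋) ⇔ sat ℓ q ⌊ conjP r s ⌋
  conjP-correct {r = r} {s} sr ss V<lo ℓ q =
    let r-s , s-r = separated sr ss V<lo
    in quantify-conj (prefix r) (matrix r) (prefix s) (matrix s) ℓ q r-s s-r

  guardP-correct : ∀ {V lo z r} → Scoped V lo r → V ⊆ (_< lo) → z < lo → ∀ ℓ q →
                   sat ℓ q (AG (impl (prop z) ⌊ r ⌋)) ⇔ sat ℓ q ⌊ guardP z r ⌋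
  guardP-correct {lo = lo} {z} {r} sr V<lo z<lo ℓ q =
    AG-guard (next r) (prop z) (prefix r) (matrix r) ℓ q (<-≤-trans z<lo (lo≤next sr)) P<x m<x
      (fresh-by-separation {W = _< lo} (prefix r) (prop z) (prefix-in sr) z<lo
         (λ (lo≤v , _) v<lo → <⇒≱ v<lo lo≤v))
    where
      P<x = proj₁ (scoped-bounded sr V<lo)
      m<x = proj₂ (scoped-bounded sr V<lo)

  -- apply o A B  ⇔  ∃z₁ ∃z₂. Marked o z₁ z₂ A B  for z₁, z₂ not in A, B:
  -- let z₁ and z₂ label exactly the states satisfying A and B.
  marking : ∀ o z₁ z₂ A B ℓ q → z₁ ≢ z₂ → AllVars ((_≢ z₁) ∩ (_≢ z₂)) A → AllVars ((_≢ z₁) ∩ (_≢ z₂)) B →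
            sat ℓ q (apply o A B) ⇔ sat ℓ q (exists z₁ (exists z₂ (Marked o z₁ z₂ A B)))
  marking o z₁ z₂ A B ℓ q z₁≢z₂ A-z B-z = mk⇔ forth back
    where
      GA = AG (impl (prop z₁) A)
      GB = AG (impl (prop z₂) B)
      Oz = apply o (prop z₁) (prop z₂)
      agree : ∀ {ℓ₁ ℓ₂} → Outside z₁ ℓ₁ ℓ → Outside z₂ ℓ₂ ℓ₁ → Agree ((_≢ z₁) ∩ (_≢ z₂)) ℓ₂ ℓ
      agree out₁ out₂ r {a} (a≢z₁ , a≢z₂) = trans (out₂ r a a≢z₂) (out₁ r a a≢z₁)
      forth : sat ℓ q (apply o A B) → sat ℓ q (exists z₁ (exists z₂ (Marked o z₁ z₂ A B)))
      forth h = ℓ₁ , ≔-outside ℓ z₁ _ , ℓ₂ , ≔-outside ℓ₁ z₂ _ ,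
        conj-intro {ℓ₂} {q} (conj GA GB) Oz
          (conj-intro {ℓ₂} GA GB
            (AG-intro (impl (prop z₁) A) λ π i → impl-intro {ℓ₂} (prop z₁) A (to (A-same _) ∘ to (z₁⇔A _)))
            (AG-intro (impl (prop z₂) B) λ π i → impl-intro {ℓ₂} (prop z₂) B (to (B-same _) ∘ to (z₂⇔B _))))
          (apply-mono o {ℓ = ℓ} {ℓ₂} (λ π i → from (z₁⇔A _)) (λ π i → from (z₂⇔B _)) h)
        where
          ℓ₁ = ℓ [ z₁ ≔ ⌜ (λ r → sat ℓ r A) ⌝ ]
          ℓ₂ = ℓ₁ [ z₂ ≔ ⌜ (λ r → sat ℓ r B) ⌝ ]
          A-same : ∀ r → sat ℓ r A ⇔ sat ℓ₂ r A
          ag = agree (≔-outside ℓ z₁ _) (≔-outside ℓ₁ z₂ _)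
          A-same = coincidence A A-z (λ r v → sym (ag r v))
          B-same : ∀ r → sat ℓ r B ⇔ sat ℓ₂ r B
          B-same = coincidence B B-z (λ r v → sym (ag r v))
          z₁⇔A : ∀ r → T (ℓ₂ r z₁) ⇔ sat ℓ r A
          z₁⇔A r = T-≔-outside ℓ₁ z₂ _ r z₁≢z₂ ⨾ T-≔-hit ℓ z₁ _ r ⨾ T-⌜⌝ (λ r → sat ℓ r A) r
          z₂⇔B : ∀ r → T (ℓ₂ r z₂) ⇔ sat ℓ r B
          z₂⇔B r = T-≔-hit ℓ₁ z₂ _ r ⨾ T-⌜⌝ (λ r → sat ℓ r B) r
      back : sat ℓ q (exists z₁ (exists z₂ (Marked o z₁ z₂ A B))) → sat ℓ q (apply o A B)
      back (ℓ₁ , out₁ , ℓ₂ , out₂ , body) =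
        apply-mono o
          (λ π i hz → to (coincidence A A-z ag _)
                        (impl-elim (prop z₁) A (AG-elim (impl (prop z₁) A) hGA π i) hz))
          (λ π i hz → to (coincidence B B-z ag _)
                        (impl-elim (prop z₂) B (AG-elim (impl (prop z₂) B) hGB π i) hz))
          (conj-elim₂ {ℓ₂} {q} (conj GA GB) Oz body)
        where
          ag = agree out₁ out₂
          hG = conj-elim₁ {ℓ₂} {q} (conj GA GB) Oz body
          hGA = conj-elim₁ {ℓ₂} {q} GA GB hG
          hGB = conj-elim₂ {ℓ₂} {q} GA GB hG

  opP-correct : ∀ {V} o k {r s} → V ⊆ (_< k) → Scoped V (suc (suc k)) r →
                Scoped V (next (guardP k r)) s → ∀ ℓ q →
                sat ℓ q (apply o ⌊ r ⌋ ⌊ s ⌋) ⇔ sat ℓ q ⌊ opP o k r s ⌋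
  opP-correct {V} o k {r} {s} V<k sr ss ℓ q =
    marking o k (suc k) ⌊ r ⌋ ⌊ s ⌋ ℓ q (<⇒≢ (n<1+n k))
            (avoids-markers V<k ≤-refl sr) (avoids-markers V<k (lo≤next sg₁) ss)
    ⨾ quantify-cong ((true , k) ∷ (true , suc k) ∷ []) {Marked o k (suc k) ⌊ r ⌋ ⌊ s ⌋} {⌊ c ⌋} inner ℓ q
    where
      V′ = (V ∪ ｛ k ｝) ∪ ｛ suc k ｝
      g₁ = guardP k r
      g₂ = guardP (suc k) s
      Oz = apply o (prop k) (prop (suc k))
      c = conjP (conjP g₁ g₂) (plain Oz (next g₂))
      GA = AG (impl (prop k) ⌊ r ⌋)
      GB = AG (impl (prop (suc k)) ⌊ s ⌋)
      V′<2+k : V′ ⊆ (_< suc (suc k))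
      V′<2+k = markers-below V<k
      sr′ = scoped-weaken (inj₁ ∘ inj₁) sr
      ss′ = scoped-weaken (inj₁ ∘ inj₁) ss
      sg₁ = guardP-scoped (inj₁ (inj₂ refl)) sr′
      sg₂ = guardP-scoped (inj₂ refl) ss′
      V′<g₁ : V′ ⊆ (_< next g₁)
      V′<g₁ v = <-≤-trans (V′<2+k v) (lo≤next sg₁)
      inner : Equivalent (Marked o k (suc k) ⌊ r ⌋ ⌊ s ⌋) ⌊ c ⌋
      inner ℓ′ q′ =
        conj-cong {φ = conj GA GB} {⌊ conjP g₁ g₂ ⌋} {Oz} {Oz}
          (conj-cong {φ = GA} {⌊ g₁ ⌋} {GB} {⌊ g₂ ⌋}
                     (guardP-correct sr′ V′<2+k (m<n⇒m<1+n (n<1+n k)) ℓ′ q′)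
                     (guardP-correct ss′ V′<g₁ (V′<g₁ (inj₂ refl)) ℓ′ q′)
           ⨾ conjP-correct sg₁ sg₂ V′<2+k ℓ′ q′)
          ⇔.refl
        ⨾ conjP-correct (conjP-scoped sg₁ sg₂)
                        (plain-scoped {V′} _ (apply-vars o (inj₁ (inj₂ refl)) (inj₂ refl))) V′<2+k ℓ′ q′

  Faithful : (AP → AP) → ℕ → Labelling → Labelling → Pred AP 0ℓ
  Faithful σ k ℓ ℓ′ a = σ a < k × (∀ r → ℓ′ r (σ a) ≡ ℓ r a)

  faithful-raise : ∀ σ ℓ ℓ′ {k k′} → k ≤ k′ → ∀ φ → AllVars (Faithful σ k ℓ ℓ′) φ →
                   AllVars (Faithful σ k′ ℓ ℓ′) φ
  faithful-raise σ ℓ ℓ′ k≤k′ = AllVars-map (λ (σa<k , same) → <-≤-trans σa<k k≤k′ , same)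

  mutual
    translate-correct : ∀ φ σ k ℓ ℓ′ q → AllVars (Faithful σ k ℓ ℓ′) φ →
                        sat ℓ q φ ⇔ sat ℓ′ q ⌊ translate σ k φ ⌋
    translate-correct (prop a) σ k ℓ ℓ′ q (_ , same) = mk⇔ (subst T (sym (same q))) (subst T (same q))
    translate-correct (neg φ) σ k ℓ ℓ′ q h =
      ¬-cong-⇔ (translate-correct φ σ k ℓ ℓ′ q h) ⨾ negP-correct (translate σ k φ) ℓ′ q
    translate-correct (or φ ψ) σ k ℓ ℓ′ q (hφ , hψ) =
      (translate-correct φ σ k ℓ ℓ′ q hφ ⊎-⇔
       translate-correct ψ σ (next r) ℓ ℓ′ q (faithful-raise σ ℓ ℓ′ (lo≤next sr) ψ hψ))
      ⨾ orP-correct sr (translate-scoped σ (next r) ψ (AllVars-map proj₁ ψ hψ)) id ℓ′ q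
      where
        r = translate σ k φ
        sr = translate-scoped σ k φ (AllVars-map proj₁ φ hφ)
    translate-correct (exists p φ) σ k ℓ ℓ′ q (_ , h) = mk⇔ forth back
      where
        σ′ = σ [ p ↦ k ]
        IH : ∀ ℓ₁ ℓ₁′ → AllVars (Faithful σ′ (suc k) ℓ₁ ℓ₁′) φ →
             sat ℓ₁ q φ ⇔ sat ℓ₁′ q ⌊ translate σ′ (suc k) φ ⌋
        IH ℓ₁ ℓ₁′ = translate-correct φ σ′ (suc k) ℓ₁ ℓ₁′ q
        extend : ∀ {ℓ₁ ℓ₁′} → Outside p ℓ₁ ℓ → Outside k ℓ₁′ ℓ′ → (∀ r → ℓ₁′ r k ≡ ℓ₁ r p) →
                 AllVars (Faithful σ′ (suc k) ℓ₁ ℓ₁′) φ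
        extend {ℓ₁} {ℓ₁′} out-p out-k same-k = AllVars-map renamed φ h
          where
            renamed : Faithful σ k ℓ ℓ′ ⊆ Faithful σ′ (suc k) ℓ₁ ℓ₁′
            renamed {a} (σa<k , same) with a ≟ p
            ... | yes refl = ≤-refl , same-k
            ... | no  a≢p  = m<n⇒m<1+n σa<k ,
                             λ r → trans (out-k r (σ a) (<⇒≢ σa<k)) (trans (same r) (sym (out-p r a a≢p)))
        forth : sat ℓ q (exists p φ) → sat ℓ′ q (exists k ⌊ translate σ′ (suc k) φ ⌋)
        forth (ℓ₁ , out , h₁) =
          ℓ₁′ , ≔-outside ℓ′ k _ , to (IH ℓ₁ ℓ₁′ (extend out (≔-outside ℓ′ k _) (≔-hit ℓ′ k _))) h₁
          where ℓ₁′ = ℓ′ [ k ≔ (λ r → ℓ₁ r p) ]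
        back : sat ℓ′ q (exists k ⌊ translate σ′ (suc k) φ ⌋) → sat ℓ q (exists p φ)
        back (ℓ₁′ , out , h₁) =
          ℓ₁ , ≔-outside ℓ p _ , from (IH ℓ₁ ℓ₁′ (extend (≔-outside ℓ p _) out (sym ∘ ≔-hit ℓ p _))) h₁
          where ℓ₁ = ℓ [ p ≔ (λ r → ℓ₁′ r k) ]
    translate-correct (EU φ ψ) σ k ℓ ℓ′ q (hφ , hψ) = translateOp-correct σ k opEU φ ψ ℓ ℓ′ q hφ hψ
    translate-correct (AU φ ψ) σ k ℓ ℓ′ q (hφ , hψ) = translateOp-correct σ k opAU φ ψ ℓ ℓ′ q hφ hψ
    translate-correct (EX φ)   σ k ℓ ℓ′ q h         = translateOp-correct σ k opEX φ φ ℓ ℓ′ q h h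
    translate-correct (AX φ)   σ k ℓ ℓ′ q h         = translateOp-correct σ k opAX φ φ ℓ ℓ′ q h h

    translateOp-correct : ∀ σ k o φ ψ ℓ ℓ′ q →
                          AllVars (Faithful σ k ℓ ℓ′) φ → AllVars (Faithful σ k ℓ ℓ′) ψ →
                          sat ℓ q (apply o φ ψ) ⇔ sat ℓ′ q ⌊ translateOp σ k o φ ψ ⌋
    translateOp-correct σ k o φ ψ ℓ ℓ′ q hφ hψ =
      apply-cong o (λ r′ → translate-correct φ σ _ ℓ ℓ′ r′ (faithful-raise σ ℓ ℓ′ k≤2+k φ hφ))
                   (λ r′ → translate-correct ψ σ _ ℓ ℓ′ r′ (faithful-raise σ ℓ ℓ′ k≤s ψ hψ))
      ⨾ opP-correct o k id sr ss ℓ′ q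
      where
        sr = translate-scoped σ _ φ (AllVars-map proj₁ φ hφ)
        ss = translate-scoped σ _ ψ (AllVars-map proj₁ ψ hψ)
        k≤2+k = ≤-trans (n≤1+n k) (n≤1+n (suc k))
        k≤s = ≤-trans k≤2+k (≤-trans (lo≤next sr) (≤-trans (n≤1+n _) (n≤1+n _)))

eqctl-normal-form : ExcludedMiddle 0ℓ → (φ : Form) →
  Σ Form λ ψ → IsEQCTL ψ × (∀ {Q : Set} (R : Q → Q → Set) ℓ q → satL R ℓ q φ ⇔ satL R ℓ q ψ)
eqctl-normal-form em φ =
  ⌊ t ⌋ , quantify-EQCTL (prefix t) (translate-CTL id b φ) ,
  λ R ℓ q → Semantics.translate-correct em R φ id b ℓ ℓ q
              (AllVars-map (λ a<b → a<b , λ _ → refl) φ (varBound-sound φ))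
  where
    b = varBound φ
    t = translate id b φ

proposition3p1 : ExcludedMiddle 0ℓ →
    ((φ : Form) → Σ Form (λ ψ → IsEQCTL ψ × (φ ≡s ψ)))
    × ((φ : Form) → Σ Form (λ ψ′ → IsEQCTL ψ′ × (φ ≡t ψ′)))
proposition3p1 em = structure , tree
  where
    structure : (φ : Form) → Σ Form (λ ψ → IsEQCTL ψ × (φ ≡s ψ))
    structure φ = let ψ , ψ-EQCTL , equiv = eqctl-normal-form em φ
                  in ψ , ψ-EQCTL , λ S q → equiv _ _ q
    tree : (φ : Form) → Σ Form (λ ψ′ → IsEQCTL ψ′ × (φ ≡t ψ′))
    tree φ = let ψ , ψ-EQCTL , equiv = eqctl-normal-form em φ
             in ψ , ψ-EQCTL , λ S q → equiv _ _ (Unwind.root S q)
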